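{- Let $p$ be an odd prime, $k>0$ an integer, $n = 2p^k$, and let $G = C_n(S)$ be a circulant graph with $S\subseteq\{1,\ldots,p^k\}$. Let $f_{p^k-1}$ denote the number of cliques of $G$ of cardinality $p^k$. If $f_{p^k-1} \neq 0$, then $$f_{p^k-1} \equiv 2 \pmod p.$$ Moreover, if $f_{p^k-1}\neq 0$ and one of the following conditions holds: (a) $1 \notin S$; (b) $1 \in S$ and there exists $t \in \{1,\ldots,p^k\}$ with $\gcd(t,2p)=1$ and $t \notin S$; then $f_{p^k-1} = 2$.
   Context: For $S \subseteq \{1,\ldots,\lfloor n/2\rfloor\}$, the circulant graph $C_n(S)$ is the simple graph with vertex set $\mathbb{Z}_n=\{0,\ldots,n-1\}$ and edge set $\{\{i,j\} : |j-i|_n \in S\}$, where $|k|_n=\min\{|k|, n-|k|\}$. A clique is a set of pairwise adjacent vertices. -}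

module Defs where

open import Data.Bool using (Bool; true; false; _∧_; not; if_then_else_)
open import Data.Nat using (ℕ; zero; suc; _+_; _*_; _∸_; _⊓_; ∣_-_∣; _≡ᵇ_)
open import Data.Fin using (Fin; toℕ)
open import Data.Fin.Subset using (Subset)
open import Data.Vec using (Vec; []; _∷_; lookup)
open import Data.List using (List; []; _∷_; map; _++_; allFin; filter; length)

allB : {A : Set} → (A → Bool) → List A → Bool
allB f [] = true
allB f (x ∷ xs) = f x ∧ allB f xs
import Data.Bool.Properties
open import Relation.Nullary.Decidable using (Dec; yes; no)
open import Relation.Binary.PropositionalEquality using (_≡_)

circDist : (n : ℕ) → ℕ → ℕ → ℕ
circDist n i j = ∣ i - j ∣ ⊓ (n ∸ ∣ i - j ∣)

adjB : (S : ℕ → Bool) (n : ℕ) → Fin n → Fin n → Bool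
adjB S n i j = not (toℕ i ≡ᵇ toℕ j) ∧ S (circDist n (toℕ i) (toℕ j))

isCliqueB : (S : ℕ → Bool) (n : ℕ) → Subset n → Bool
isCliqueB S n A =
  allB (λ i → allB (λ j →
        if lookup A i ∧ lookup A j ∧ not (toℕ i ≡ᵇ toℕ j)
        then adjB S n i j else true) (allFin n)) (allFin n)

sizeB : ∀ {n} → Subset n → ℕ
sizeB [] = 0
sizeB (true ∷ A) = suc (sizeB A)
sizeB (false ∷ A) = sizeB A

allSubsets : (n : ℕ) → List (Subset n)
allSubsets zero = [] ∷ []
allSubsets (suc n) = map (true ∷_) (allSubsets n) ++ map (false ∷_) (allSubsets n)

numCliques : (S : ℕ → Bool) (n m : ℕ) → ℕ
numCliques S n m =
  length (filter (λ A → Data.Bool.Properties.T? (isCliqueB S n A ∧ (sizeB A ≡ᵇ m))) (allSubsets n))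

-- Let σ rotate ℤ_{2m} by two places, with m = p^k.  σ acts on the m-cliques of C_{2m}(S) and
-- σ^m = id, so their number is congruent mod p to the number of σ-fixed m-cliques.  A σ-fixed set
-- is a union of parity classes, so a fixed m-clique is the set of even or of odd vertices.  Both
-- are cliques once some m-clique A exists: if an even distance d = 2e ≤ m were missing from S,
-- then A and A + d would be disjoint halves of ℤ_{2m}, so A + d = ∁A; since m is odd, e·2m is an
-- odd multiple of d, giving A = A + e·2m = ∁A.  In the same way a missing distance t coprime to m
-- makes 2t and 2m, hence by Bézout 2, periods of every m-clique: all m-cliques are σ-fixed.

module Submission where

open import Defs
open import Data.Bool using (Bool; true; false; not; T; _∧_; if_then_else_)
open import Data.Bool.Properties using (not-involutive; ¬-not; not-¬; T?; T-∧; T-≡)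
  renaming (_≟_ to _≟ᵇ_)
open import Data.Empty using (⊥; ⊥-elim)
open import Data.Fin using (toℕ; fromℕ<) renaming (zero to fzero; suc to fsuc)
open import Data.Fin.Properties using (toℕ-fromℕ<; toℕ<n)
open import Data.Integer using (+_; _-_)
open import Data.Integer.Divisibility using (_∣_)
open import Data.List using (List; []; _∷_; length; filter; applyUpTo; allFin; map)
open import Data.List.Properties
  using (filter-all; filter-≐; filter-accept; filter-reject; length-applyUpTo)
open import Data.List.Membership.Propositional using (_∈_; find)
open import Data.List.Membership.Propositional.Properties
  using (∈-filter⁺; ∈-filter⁻; ∈-applyUpTo⁺; ∈-applyUpTo⁻; ∈-allFin; ∈-map⁺; ∈-map⁻; ∈-++⁺ˡ; ∈-++⁺ʳ)
open import Data.List.Relation.Unary.All as All using (All; []; _∷_; all?)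
open import Data.List.Relation.Unary.All.Properties using (¬All⇒Any¬)
open import Data.List.Relation.Unary.AllPairs using ([]; _∷_)
open import Data.List.Relation.Unary.Any using (here; there)
open import Data.List.Relation.Unary.Unique.Propositional using (Unique)
import Data.List.Relation.Unary.Unique.Propositional.Properties as Unique
open import Data.Nat
  using (ℕ; zero; suc; _+_; _*_; _∸_; _^_; _%_; _⊓_; ∣_-_∣; _≡ᵇ_; _<_; _≤_; z≤n; s≤s; z<s; s≤s⁻¹; pred;
         NonZero; >-nonZero; >-nonZero⁻¹; ≢-nonZero⁻¹)
open import Data.Nat.Properties
open import Data.Nat.Coprimality
  using (Coprime; coprime-Bézout; prime⇒coprime; coprime-divisor; gcd≡1⇒coprime; 1-coprimeTo)
import Data.Nat.Coprimality as Coprime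
import Data.Nat.Divisibility as ℕ
open import Data.Nat.Divisibility using (divides; ∣-trans; ∣1⇒≡1; n∣m*n)
open import Data.Nat.DivMod
  using (_/_; m≡m%n+[m/n]*n; %-congˡ; [m+n]%n≡m%n; %-distribˡ-+; m%n%n≡m%n; m<n⇒m%n≡m; n%n≡0; m%n<n)
open import Data.Nat.GCD using (gcd; module Bézout)
open import Data.Nat.GeneralisedArithmetic using (iterate)
open import Data.Nat.Primality using (Prime; prime⇒nonZero; prime⇒irreducible)
open import Data.Nat.Tactic.RingSolver using (solve-∀)
open import Data.Product using (_×_; _,_; proj₁; proj₂; ∃-syntax)
open import Data.Sum using (_⊎_; inj₁; inj₂)
open import Data.Vec using (Vec; []; _∷_; lookup; _∷ʳ_)
open import Data.Vec.Properties using (∷-injectiveʳ; ≡-dec)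
open import Function using (_∘_)
open import Function.Bundles using (Equivalence)
open import Level using (0ℓ)
open import Relation.Binary.Definitions using (DecidableEquality)
open import Relation.Binary.PropositionalEquality
open import Relation.Nullary using (¬_; Dec; yes; no; ¬?; contradiction)
open import Relation.Unary using (Pred; Decidable)
open import Relation.Unary.Properties using (_∩?_)

coprime⇒closure∋1 : (I : ℕ → Set) →
  (∀ a b → I a → I b → I (a + b)) → (∀ a b → I a → I (a + b) → I b) →
  ∀ {a b} → I a → I b → Coprime a b → I 1
coprime⇒closure∋1 I +-closed ∸-closed {a} {b} Ia Ib a⊥b = fromBézout (coprime-Bézout a⊥b)
  where
  multiples : ∀ {c} k → I c → I (k * c)
  multiples zero    _  = ∸-closed a 0 Ia (subst I (sym (+-identityʳ a)) Ia)
  multiples {c} (suc k) Ic = +-closed c (k * c) Ic (multiples k Ic)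

  combination : ∀ {c d} x y → I c → I d → 1 + y * d ≡ x * c → I 1
  combination {d = d} x y Ic Id eq =
    ∸-closed (y * d) 1 (multiples y Id) (subst I (trans (sym eq) (+-comm 1 (y * d))) (multiples x Ic))

  fromBézout : Bézout.Identity 1 a b → I 1
  fromBézout (Bézout.+- x y eq) = combination x y Ia Ib eq
  fromBézout (Bézout.-+ x y eq) = combination y x Ib Ia eq

coprime-*ʳ : ∀ {t a b} → Coprime t a → Coprime t b → Coprime t (a * b)
coprime-*ʳ t⊥a t⊥b (d∣t , d∣ab) = t⊥b (d∣t , coprime-divisor (λ (e∣d , e∣a) → t⊥a (∣-trans e∣d d∣t , e∣a)) d∣ab)

coprime-^ʳ : ∀ {t a} → Coprime t a → ∀ k → Coprime t (a ^ k)
coprime-^ʳ t⊥a zero    (_ , d∣1) = ∣1⇒≡1 d∣1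
coprime-^ʳ t⊥a (suc k) = coprime-*ʳ t⊥a (coprime-^ʳ t⊥a k)

coprime-∣ʳ : ∀ {t a b} → Coprime t a → b ℕ.∣ a → Coprime t b
coprime-∣ʳ t⊥a b∣a (d∣t , d∣b) = t⊥a (d∣t , ∣-trans d∣b b∣a)

prime≢2⇒odd : ∀ {p} → Prime p → p ≢ 2 → ∃[ q ] p ≡ 1 + 2 * q
prime≢2⇒odd {p} p-prime p≢2 with p % 2 | m%n<n p 2 | m≡m%n+[m/n]*n p 2
... | 0 | _ | p≡[p/2]*2 with prime⇒irreducible p-prime (divides (p / 2) p≡[p/2]*2)
...   | inj₁ ()
...   | inj₂ 2≡p = contradiction (sym 2≡p) p≢2
prime≢2⇒odd {p} p-prime p≢2 | 1 | _ | p≡1+[p/2]*2 = p / 2 , trans p≡1+[p/2]*2 (cong suc (*-comm (p / 2) 2))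
prime≢2⇒odd {p} p-prime p≢2 | suc (suc _) | s≤s (s≤s ()) | _

odd*odd : ∀ a b → (1 + 2 * a) * (1 + 2 * b) ≡ 1 + 2 * (a + b + 2 * a * b)
odd*odd = solve-∀

odd-^ : ∀ {p} q → p ≡ 1 + 2 * q → ∀ k → ∃[ r ] p ^ k ≡ 1 + 2 * r
odd-^ q p-odd zero = 0 , refl
odd-^ q p-odd (suc k) with odd-^ q p-odd k
... | r , p^k-odd = q + r + 2 * q * r , trans (cong₂ _*_ p-odd p^k-odd) (odd*odd q r)

module _ {A : Set} (f : A → A) where

  iterate-+ : ∀ x a b → iterate f x (a + b) ≡ iterate f (iterate f x a) b
  iterate-+ x zero    b = refl
  iterate-+ x (suc a) b = iterate-+ (f x) a b

  iterate-* : ∀ x a b → iterate f x (a * b) ≡ iterate (λ y → iterate f y b) x a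
  iterate-* x zero    b = refl
  iterate-* x (suc a) b = trans (iterate-+ x b (a * b)) (iterate-* (iterate f x b) a b)

  iterate-suc : ∀ x n → iterate f x (suc n) ≡ f (iterate f x n)
  iterate-suc x zero    = refl
  iterate-suc x (suc n) = iterate-suc (f x) n

  iterate-fixed : ∀ {x} → f x ≡ x → ∀ n → iterate f x n ≡ x
  iterate-fixed fx zero    = refl
  iterate-fixed fx (suc n) = trans (cong (λ y → iterate f y n) fx) (iterate-fixed fx n)

coprime-periods⇒fixed : ∀ {A : Set} (f : A → A) {x a b} →
  iterate f x a ≡ x → iterate f x b ≡ x → Coprime a b → f x ≡ x
coprime-periods⇒fixed f {x} = coprime⇒closure∋1 Period +-closed ∸-closed
  where
  Period : ℕ → Set
  Period s = iterate f x s ≡ x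

  +-closed : ∀ a b → Period a → Period b → Period (a + b)
  +-closed a b Pa Pb = trans (iterate-+ f x a b) (trans (cong (λ y → iterate f y b) Pa) Pb)

  ∸-closed : ∀ a b → Period a → Period (a + b) → Period b
  ∸-closed a b Pa Pab = trans (cong (λ y → iterate f y b) (sym Pa)) (trans (sym (iterate-+ f x a b)) Pab)

module _ {A : Set} {P Q : Pred A 0ℓ} (P? : Decidable P) (Q? : Decidable Q) where

  filter-filter : ∀ xs → filter P? (filter Q? xs) ≡ filter (P? ∩? Q?) xs
  filter-filter []       = refl
  filter-filter (x ∷ xs) = step (P? x) (Q? x)
    where
    step : Dec (P x) → Dec (Q x) → filter P? (filter Q? (x ∷ xs)) ≡ filter (P? ∩? Q?) (x ∷ xs)
    step _ (no ¬q) = trans (cong (filter P?) (filter-reject Q? ¬q))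
      (trans (filter-filter xs) (sym (filter-reject (P? ∩? Q?) (¬q ∘ proj₂))))
    step (yes p) (yes q) = trans (cong (filter P?) (filter-accept Q? q)) (trans (filter-accept P? p)
      (trans (cong (x ∷_) (filter-filter xs)) (sym (filter-accept (P? ∩? Q?) (p , q)))))
    step (no ¬p) (yes q) = trans (cong (filter P?) (filter-accept Q? q)) (trans (filter-reject P? ¬p)
      (trans (filter-filter xs) (sym (filter-reject (P? ∩? Q?) (¬p ∘ proj₁)))))

length-unique-pair : ∀ {A : Set} {X : List A} {a b} → Unique X → (∀ {y} → y ∈ X → y ≡ a ⊎ y ≡ b) →
  a ∈ X → b ∈ X → a ≢ b → length X ≡ 2
length-unique-pair {X = []} _ _ () _ _
length-unique-pair {X = _ ∷ []} _ _ (here refl) (here refl) a≢b = contradiction refl a≢b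
length-unique-pair {X = _ ∷ _ ∷ []} _ _ _ _ _ = refl
length-unique-pair {X = x ∷ y ∷ z ∷ _} ((x≢y ∷ x≢z ∷ _) ∷ (y≢z ∷ _) ∷ _) X⊆ab _ _ _ =
  ⊥-elim (pigeonhole (X⊆ab (here refl)) (X⊆ab (there (here refl))) (X⊆ab (there (there (here refl)))))
  where
  pigeonhole : ∀ {a b} → x ≡ a ⊎ x ≡ b → y ≡ a ⊎ y ≡ b → z ≡ a ⊎ z ≡ b → ⊥
  pigeonhole (inj₁ refl) (inj₁ y≡x) _ = contradiction (sym y≡x) x≢y
  pigeonhole (inj₂ refl) (inj₂ y≡x) _ = contradiction (sym y≡x) x≢y
  pigeonhole (inj₁ refl) (inj₂ refl) (inj₁ z≡x) = contradiction (sym z≡x) x≢z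
  pigeonhole (inj₁ refl) (inj₂ refl) (inj₂ z≡y) = contradiction (sym z≡y) y≢z
  pigeonhole (inj₂ refl) (inj₁ refl) (inj₁ z≡y) = contradiction (sym z≡y) y≢z
  pigeonhole (inj₂ refl) (inj₁ refl) (inj₂ z≡x) = contradiction (sym z≡x) x≢z

∈-allSubsets : ∀ {n} (A : Vec Bool n) → A ∈ allSubsets n
∈-allSubsets []          = here refl
∈-allSubsets (true ∷ A)  = ∈-++⁺ˡ (∈-map⁺ (true ∷_) (∈-allSubsets A))
∈-allSubsets (false ∷ A) = ∈-++⁺ʳ (map (true ∷_) (allSubsets _)) (∈-map⁺ (false ∷_) (∈-allSubsets A))

allSubsets-unique : ∀ n → Unique (allSubsets n)
allSubsets-unique zero    = [] ∷ []
allSubsets-unique (suc n) =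
  Unique.++⁺ (Unique.map⁺ ∷-injectiveʳ (allSubsets-unique n)) (Unique.map⁺ ∷-injectiveʳ (allSubsets-unique n))
    disjoint
  where
  disjoint : ∀ {A} → ¬ (A ∈ map (true ∷_) (allSubsets n) × A ∈ map (false ∷_) (allSubsets n))
  disjoint (A∈ , A∈′) with ∈-map⁻ (true ∷_) A∈ | ∈-map⁻ (false ∷_) A∈′
  ... | _ , _ , refl | _ , _ , ()

nonempty⇒∈ : ∀ {A : Set} {xs : List A} → length xs ≢ 0 → ∃[ x ] x ∈ xs
nonempty⇒∈ {xs = []}    |xs|≢0 = contradiction refl |xs|≢0
nonempty⇒∈ {xs = x ∷ _} _      = x , here refl

-- Counting fixed points modulo p

infix 4 _≡_+multipleOf_

_≡_+multipleOf_ : ℕ → ℕ → ℕ → Set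
a ≡ b +multipleOf p = ∃[ q ] a ≡ b + q * p

+multipleOf-refl : ∀ {a p} → a ≡ a +multipleOf p
+multipleOf-refl = 0 , sym (+-identityʳ _)

+multipleOf-trans : ∀ {a b c p} → a ≡ b +multipleOf p → b ≡ c +multipleOf p → a ≡ c +multipleOf p
+multipleOf-trans {a} {b} {c} {p} (q₁ , a≡b+q₁p) (q₂ , b≡c+q₂p) = q₂ + q₁ , (begin
  a                        ≡⟨ a≡b+q₁p ⟩
  b + q₁ * p               ≡⟨ cong (_+ q₁ * p) b≡c+q₂p ⟩
  c + q₂ * p + q₁ * p      ≡⟨ +-assoc c (q₂ * p) (q₁ * p) ⟩
  c + (q₂ * p + q₁ * p)    ≡⟨ cong (_+_ c) (sym (*-distribʳ-+ p q₂ q₁)) ⟩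
  c + (q₂ + q₁) * p        ∎)
  where open ≡-Reasoning

module FixedPointCount {A : Set} (_≟_ : DecidableEquality A) where

  open import Data.List.Membership.DecPropositional _≟_ using (_∉?_)

  Invariant : (A → A) → List A → Set
  Invariant f X = ∀ {x} → x ∈ X → f x ∈ X

  fixed? : (f : A → A) → Decidable (λ x → f x ≡ x)
  fixed? f x = f x ≟ x

  iterate-∈ : ∀ {f X} → Invariant f X → ∀ {x} → x ∈ X → ∀ n → iterate f x n ∈ X
  iterate-∈ inv x∈X zero    = x∈X
  iterate-∈ inv x∈X (suc n) = iterate-∈ inv (inv x∈X) n

  length-remove : ∀ {X y} → Unique X → y ∈ X → length X ≡ suc (length (filter (λ z → ¬? (z ≟ y)) X))
  length-remove {x ∷ X} (x∉X ∷ _) (here refl) = cong suc (cong length (sym (begin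
    filter (λ z → ¬? (z ≟ x)) (x ∷ X) ≡⟨ filter-reject (λ z → ¬? (z ≟ x)) (λ x≢x → x≢x refl) ⟩
    filter (λ z → ¬? (z ≟ x)) X       ≡⟨ filter-all (λ z → ¬? (z ≟ x)) (All.map (λ x≢z z≡x → x≢z (sym z≡x)) x∉X) ⟩
    X                                 ∎)))
    where open ≡-Reasoning
  length-remove {x ∷ X} (x∉X ∷ uX) (there y∈X) = cong suc (trans (length-remove uX y∈X)
    (cong length (sym (filter-accept (λ z → ¬? (z ≟ _)) (All.lookup x∉X y∈X)))))

  length-removeAll : ∀ {X} O → Unique O → Unique X → (∀ {y} → y ∈ O → y ∈ X) →
    length X ≡ length (filter (_∉? O) X) + length O
  length-removeAll {X} [] _ _ _ =
    trans (cong length (sym (filter-all (_∉? []) {X} (All.tabulate (λ _ ()))))) (sym (+-identityʳ _))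
  length-removeAll {X} (y ∷ O) (y∉O ∷ uO) uX O⊆X = begin
    length X                                          ≡⟨ length-remove uX (O⊆X (here refl)) ⟩
    suc (length X')                                   ≡⟨ cong suc (length-removeAll O uO X'-unique O⊆X') ⟩
    suc (length (filter (_∉? O) X') + length O)       ≡⟨ cong (λ l → suc (length l + length O)) filter-∉ ⟩
    suc (length (filter (_∉? (y ∷ O)) X) + length O)  ≡⟨ sym (+-suc _ _) ⟩
    length (filter (_∉? (y ∷ O)) X) + length (y ∷ O)  ∎
    where
    open ≡-Reasoning
    X' : List A
    X' = filter (λ z → ¬? (z ≟ y)) X
    X'-unique : Unique X'
    X'-unique = Unique.filter⁺ _ uX
    O⊆X' : ∀ {z} → z ∈ O → z ∈ X'
    O⊆X' z∈O = ∈-filter⁺ _ (O⊆X (there z∈O)) (λ z≡y → All.lookup y∉O z∈O (sym z≡y))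
    filter-∉ : filter (_∉? O) X' ≡ filter (_∉? (y ∷ O)) X
    filter-∉ = trans (filter-filter (_∉? O) (λ z → ¬? (z ≟ y)) X)
      (filter-≐ _ (_∉? (y ∷ O))
        ((λ (z∉O , z≢y) → λ { (here z≡y) → z≢y z≡y ; (there z∈O) → z∉O z∈O })
        , (λ z∉yO → (z∉yO ∘ there) , (z∉yO ∘ here))) X)

  PeriodicOn : (A → A) → ℕ → List A → Set
  PeriodicOn τ p X = ∀ {x} → x ∈ X → iterate τ x p ≡ x

  module Orbit (τ : A → A) {p} (p-prime : Prime p) {X} (uX : Unique X) (inv : Invariant τ X)
               (per : PeriodicOn τ p X) {x} (x∈X : x ∈ X) (x-moves : τ x ≢ x) where

    orbit : List A
    orbit = applyUpTo (iterate τ x) p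

    orbit-distinct : ∀ {i j} → i < j → j < p → iterate τ x i ≢ iterate τ x j
    orbit-distinct {i} {j} i<j j<p τⁱx≡τʲx = x-moves (coprime-periods⇒fixed τ returns (per x∈X) coprime)
      where
      s : ℕ
      s = p ∸ j
      returns : iterate τ x (i + s) ≡ x
      returns = begin
        iterate τ x (i + s)          ≡⟨ iterate-+ τ x i s ⟩
        iterate τ (iterate τ x i) s  ≡⟨ cong (λ y → iterate τ y s) τⁱx≡τʲx ⟩
        iterate τ (iterate τ x j) s  ≡⟨ sym (iterate-+ τ x j s) ⟩
        iterate τ x (j + s)          ≡⟨ cong (iterate τ x) (m+[n∸m]≡n (<⇒≤ j<p)) ⟩
        iterate τ x p                ≡⟨ per x∈X ⟩
        x                            ∎
        where open ≡-Reasoning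
      0<i+s : 0 < i + s
      0<i+s = <-≤-trans (m<n⇒0<n∸m j<p) (m≤n+m s i)
      i+s<p : i + s < p
      i+s<p = subst (i + s <_) (m+[n∸m]≡n (<⇒≤ j<p)) (+-monoˡ-< s i<j)
      coprime : Coprime (i + s) p
      coprime = Coprime.sym (prime⇒coprime p-prime {{>-nonZero 0<i+s}} i+s<p)

    orbit-unique : Unique orbit
    orbit-unique = Unique.applyUpTo⁺₁ (iterate τ x) p orbit-distinct

    orbit-invariant : Invariant τ orbit
    orbit-invariant y∈orbit with ∈-applyUpTo⁻ (iterate τ x) y∈orbit
    ... | i , i<p , refl with m≤n⇒m<n∨m≡n i<p
    ...   | inj₁ 1+i<p = subst (_∈ orbit) (iterate-suc τ x i) (∈-applyUpTo⁺ (iterate τ x) 1+i<p)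
    ...   | inj₂ 1+i≡p = subst (_∈ orbit)
      (trans (sym (per x∈X)) (trans (cong (iterate τ x) (sym 1+i≡p)) (iterate-suc τ x i)))
      (∈-applyUpTo⁺ (iterate τ x) {0} (<-≤-trans z<s i<p))

    orbit-moves : ∀ {y} → y ∈ orbit → τ y ≢ y
    orbit-moves y∈orbit τy≡y with ∈-applyUpTo⁻ (iterate τ x) y∈orbit
    ... | i , i<p , refl = x-moves (subst (λ z → τ z ≡ z) (sym x≡τⁱx) τy≡y)
      where
      x≡τⁱx : x ≡ iterate τ x i
      x≡τⁱx = begin
        x                                  ≡⟨ sym (per x∈X) ⟩
        iterate τ x p                      ≡⟨ cong (iterate τ x) (sym (m+[n∸m]≡n (<⇒≤ i<p))) ⟩
        iterate τ x (i + (p ∸ i))          ≡⟨ iterate-+ τ x i (p ∸ i) ⟩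
        iterate τ (iterate τ x i) (p ∸ i)  ≡⟨ iterate-fixed τ τy≡y (p ∸ i) ⟩
        iterate τ x i                      ∎
        where open ≡-Reasoning

    orbit⊆X : ∀ {y} → y ∈ orbit → y ∈ X
    orbit⊆X y∈orbit with ∈-applyUpTo⁻ (iterate τ x) y∈orbit
    ... | i , _ , refl = iterate-∈ inv x∈X i

    rest : List A
    rest = filter (_∉? orbit) X

    length-rest : length X ≡ length rest +multipleOf p
    length-rest = 1 , trans (length-removeAll orbit orbit-unique uX orbit⊆X)
      (cong (_+_ (length rest)) (trans (length-applyUpTo _ p) (sym (+-identityʳ p))))

    rest-shorter : length rest < length X
    rest-shorter =
      subst (length rest <_) (sym (trans (proj₂ length-rest) (cong (_+_ (length rest)) (+-identityʳ p))))
      (m<m+n (length rest) (>-nonZero⁻¹ p {{prime⇒nonZero p-prime}}))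

    rest-unique : Unique rest
    rest-unique = Unique.filter⁺ (_∉? orbit) uX

    rest-periodic : PeriodicOn τ p rest
    rest-periodic = per ∘ proj₁ ∘ ∈-filter⁻ (_∉? orbit)

    rest-invariant : Invariant τ rest
    rest-invariant {y} y∈rest with ∈-filter⁻ (_∉? orbit) y∈rest
    ... | y∈X , y∉orbit = ∈-filter⁺ (_∉? orbit) (inv y∈X) (y∉orbit ∘ τy∈orbit⇒y∈orbit)
      where
      τy∈orbit⇒y∈orbit : τ y ∈ orbit → y ∈ orbit
      τy∈orbit⇒y∈orbit τy∈orbit = subst (_∈ orbit)
        (trans (cong (iterate τ y) (suc-pred p {{prime⇒nonZero p-prime}})) (per y∈X))
        (iterate-∈ orbit-invariant τy∈orbit (pred p))

    fixed-rest : filter (fixed? τ) rest ≡ filter (fixed? τ) X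
    fixed-rest = trans (filter-filter (fixed? τ) (_∉? orbit) X)
      (filter-≐ _ (fixed? τ) (proj₁ , (λ τy≡y → τy≡y , λ y∈orbit → orbit-moves y∈orbit τy≡y)) X)

  count-mod-prime : ∀ (τ : A → A) {p} → Prime p → ∀ {X} → Unique X → Invariant τ X → PeriodicOn τ p X →
    length X ≡ length (filter (fixed? τ) X) +multipleOf p
  count-mod-prime τ {p} p-prime {X} = go (length X) ≤-refl
    where
    go : ∀ b {X} → length X ≤ b → Unique X → Invariant τ X → PeriodicOn τ p X →
      length X ≡ length (filter (fixed? τ) X) +multipleOf p
    go b {X} _ _ _ _ with all? (fixed? τ) X
    go b {X} _ _ _ _ | yes all-fixed = subst (λ Y → length X ≡ length Y +multipleOf p)
      (sym (filter-all (fixed? τ) all-fixed)) +multipleOf-refl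
    go zero {[]} _ _ _ _ | no ¬all-fixed = contradiction [] ¬all-fixed
    go (suc b) {X} |X|≤1+b uX inv per | no ¬all-fixed with find (¬All⇒Any¬ (fixed? τ) X ¬all-fixed)
    ... | x , x∈X , x-moves = +multipleOf-trans length-rest
      (subst (λ Y → length rest ≡ length Y +multipleOf p) fixed-rest
        (go b (s≤s⁻¹ (<-≤-trans rest-shorter |X|≤1+b)) rest-unique rest-invariant rest-periodic))
      where open Orbit τ p-prime uX inv per x∈X x-moves

  count-mod-prime-power : ∀ (σ : A → A) {p} → Prime p → ∀ k {X} →
    Unique X → Invariant σ X → PeriodicOn σ (p ^ k) X →
    length X ≡ length (filter (fixed? σ) X) +multipleOf p
  count-mod-prime-power σ {p} _ zero {X} _ _ per = subst (λ Y → length X ≡ length Y +multipleOf p)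
    (sym (filter-all (fixed? σ) (All.tabulate per))) +multipleOf-refl
  count-mod-prime-power σ {p} p-prime (suc k) {X} uX inv per =
    +multipleOf-trans (count-mod-prime τ p-prime uX τ-invariant τ-periodic)
      (subst (λ Z → length Y ≡ length Z +multipleOf p) fixed-Y
        (count-mod-prime-power σ p-prime k (Unique.filter⁺ (fixed? τ) uX) Y-invariant Y-periodic))
    where
    τ : A → A
    τ y = iterate σ y (p ^ k)

    τ-invariant : Invariant τ X
    τ-invariant x∈X = iterate-∈ inv x∈X (p ^ k)

    τ-periodic : PeriodicOn τ p X
    τ-periodic {x} x∈X = trans (sym (iterate-* σ x p (p ^ k))) (per x∈X)

    Y : List A
    Y = filter (fixed? τ) X

    Y-invariant : Invariant σ Y
    Y-invariant {y} y∈Y with ∈-filter⁻ (fixed? τ) y∈Y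
    ... | y∈X , τy≡y = ∈-filter⁺ (fixed? τ) (inv y∈X) (trans (iterate-suc σ y (p ^ k)) (cong σ τy≡y))

    Y-periodic : PeriodicOn σ (p ^ k) Y
    Y-periodic = proj₂ ∘ ∈-filter⁻ (fixed? τ) {xs = X}

    fixed-Y : filter (fixed? σ) Y ≡ filter (fixed? σ) X
    fixed-Y = trans (filter-filter (fixed? σ) (fixed? τ) X)
      (filter-≐ _ (fixed? σ) (proj₁ , (λ σy≡y → σy≡y , iterate-fixed σ σy≡y (p ^ k))) X)

infix 5 _∈ᵇ_

_∈ᵇ_ : ∀ {n} → ℕ → Vec Bool n → Bool
_     ∈ᵇ []      = false
zero  ∈ᵇ (b ∷ A) = b
suc j ∈ᵇ (b ∷ A) = j ∈ᵇ A

lookup≡∈ᵇ : ∀ {n} (A : Vec Bool n) i → lookup A i ≡ toℕ i ∈ᵇ A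
lookup≡∈ᵇ (b ∷ A) fzero    = refl
lookup≡∈ᵇ (b ∷ A) (fsuc i) = lookup≡∈ᵇ A i

∈ᵇ-ext : ∀ {n} {A B : Vec Bool n} → (∀ {j} → j < n → j ∈ᵇ A ≡ j ∈ᵇ B) → A ≡ B
∈ᵇ-ext {A = []}    {[]}    _    = refl
∈ᵇ-ext {A = a ∷ A} {b ∷ B} A≗B = cong₂ _∷_ (A≗B z<s) (∈ᵇ-ext (A≗B ∘ s≤s))

∈ᵇ-∷ʳ-< : ∀ {n} j (A : Vec Bool n) b → j < n → j ∈ᵇ (A ∷ʳ b) ≡ j ∈ᵇ A
∈ᵇ-∷ʳ-< zero    (a ∷ A) b _         = refl
∈ᵇ-∷ʳ-< (suc j) (a ∷ A) b (s≤s j<n) = ∈ᵇ-∷ʳ-< j A b j<n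

∈ᵇ-∷ʳ-last : ∀ {n} (A : Vec Bool n) b → n ∈ᵇ (A ∷ʳ b) ≡ b
∈ᵇ-∷ʳ-last []      b = refl
∈ᵇ-∷ʳ-last (a ∷ A) b = ∈ᵇ-∷ʳ-last A b

rotate : ∀ {A : Set} {n} → Vec A n → Vec A n
rotate []      = []
rotate (a ∷ A) = A ∷ʳ a

rotate² : ∀ {A : Set} {n} → Vec A n → Vec A n
rotate² A = rotate (rotate A)

∈ᵇ-rotate-< : ∀ {n} j (A : Vec Bool n) → suc j < n → j ∈ᵇ rotate A ≡ suc j ∈ᵇ A
∈ᵇ-rotate-< j (a ∷ A) (s≤s j<n) = ∈ᵇ-∷ʳ-< j A a j<n

∈ᵇ-rotate-last : ∀ {n} j (A : Vec Bool n) → suc j ≡ n → j ∈ᵇ rotate A ≡ 0 ∈ᵇ A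
∈ᵇ-rotate-last j (a ∷ A) refl = ∈ᵇ-∷ʳ-last A a

sizeB-∷ʳ : ∀ {n} (A : Vec Bool n) b → sizeB (A ∷ʳ b) ≡ sizeB (b ∷ A)
sizeB-∷ʳ []          b     = refl
sizeB-∷ʳ (true ∷ A)  true  = cong suc (sizeB-∷ʳ A true)
sizeB-∷ʳ (true ∷ A)  false = cong suc (sizeB-∷ʳ A false)
sizeB-∷ʳ (false ∷ A) true  = sizeB-∷ʳ A true
sizeB-∷ʳ (false ∷ A) false = sizeB-∷ʳ A false

sizeB-rotate : ∀ {n} (A : Vec Bool n) → sizeB (rotate A) ≡ sizeB A
sizeB-rotate []      = refl
sizeB-rotate (a ∷ A) = sizeB-∷ʳ A a

sizeB-iterate-rotate : ∀ {n} (A : Vec Bool n) d → sizeB (iterate rotate A d) ≡ sizeB A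
sizeB-iterate-rotate A zero    = refl
sizeB-iterate-rotate A (suc d) = trans (sizeB-iterate-rotate (rotate A) d) (sizeB-rotate A)

Disjoint : ∀ {n} → Vec Bool n → Vec Bool n → Set
Disjoint {n} A B = ∀ {j} → j < n → j ∈ᵇ A ≡ true → j ∈ᵇ B ≡ true → ⊥

Disjoint-tail : ∀ {n a b} {A B : Vec Bool n} → Disjoint (a ∷ A) (b ∷ B) → Disjoint A B
Disjoint-tail A∩B=∅ j<n = A∩B=∅ (s≤s j<n)

Disjoint⇒sizeB-+-≤ : ∀ {n} (A B : Vec Bool n) → Disjoint A B → sizeB A + sizeB B ≤ n
Disjoint⇒sizeB-+-≤ []          []          _     = z≤n
Disjoint⇒sizeB-+-≤ (true ∷ A)  (true ∷ B)  A∩B=∅ = ⊥-elim (A∩B=∅ z<s refl refl)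
Disjoint⇒sizeB-+-≤ (true ∷ A)  (false ∷ B) A∩B=∅ = s≤s (Disjoint⇒sizeB-+-≤ A B (Disjoint-tail A∩B=∅))
Disjoint⇒sizeB-+-≤ {suc n} (false ∷ A) (true ∷ B)  A∩B=∅ =
  subst (_≤ suc n) (sym (+-suc (sizeB A) (sizeB B))) (s≤s (Disjoint⇒sizeB-+-≤ A B (Disjoint-tail A∩B=∅)))
Disjoint⇒sizeB-+-≤ (false ∷ A) (false ∷ B) A∩B=∅ = m≤n⇒m≤1+n (Disjoint⇒sizeB-+-≤ A B (Disjoint-tail A∩B=∅))

Disjoint∧sizes⇒complement : ∀ {n} (A B : Vec Bool n) → Disjoint A B → sizeB A + sizeB B ≡ n →
  ∀ {j} → j < n → j ∈ᵇ B ≡ not (j ∈ᵇ A)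
Disjoint∧sizes⇒complement (true ∷ A) (true ∷ B) A∩B=∅ _ _ = ⊥-elim (A∩B=∅ z<s refl refl)
Disjoint∧sizes⇒complement (true ∷ A) (false ∷ B) _ _ {zero} _ = refl
Disjoint∧sizes⇒complement (true ∷ A) (false ∷ B) A∩B=∅ sizes {suc j} (s≤s j<n) =
  Disjoint∧sizes⇒complement A B (Disjoint-tail A∩B=∅) (suc-injective sizes) j<n
Disjoint∧sizes⇒complement (false ∷ A) (true ∷ B) _ _ {zero} _ = refl
Disjoint∧sizes⇒complement (false ∷ A) (true ∷ B) A∩B=∅ sizes {suc j} (s≤s j<n) =
  Disjoint∧sizes⇒complement A B (Disjoint-tail A∩B=∅)
    (suc-injective (trans (sym (+-suc (sizeB A) (sizeB B))) sizes)) j<n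
Disjoint∧sizes⇒complement (false ∷ A) (false ∷ B) A∩B=∅ sizes _ =
  ⊥-elim (<-irrefl sizes (s≤s (Disjoint⇒sizeB-+-≤ A B (Disjoint-tail A∩B=∅))))

alternate : Bool → Bool → ℕ → Bool
alternate a b zero    = a
alternate a b (suc j) = alternate b a j

alternating : Bool → Bool → ∀ n → Vec Bool n
alternating a b zero    = []
alternating a b (suc n) = a ∷ alternating b a n

∈ᵇ-alternating : ∀ a b {n} j → j < n → j ∈ᵇ alternating a b n ≡ alternate a b j
∈ᵇ-alternating a b zero    z<s       = refl
∈ᵇ-alternating a b (suc j) (s≤s j<n) = ∈ᵇ-alternating b a j j<n

alternate-true : ∀ a b j → alternate a b j ≡ true →
  (a ≡ true × ∃[ k ] j ≡ 2 * k) ⊎ (b ≡ true × ∃[ k ] j ≡ 1 + 2 * k)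
alternate-true a b zero    a≡true = inj₁ (a≡true , 0 , refl)
alternate-true a b (suc j) alt≡true with alternate-true b a j alt≡true
... | inj₁ (b≡true , k , j≡2k)   = inj₂ (b≡true , k , cong suc j≡2k)
... | inj₂ (a≡true , k , j≡1+2k) = inj₁ (a≡true , suc k , trans (cong suc j≡1+2k) (sym (*-suc 2 k)))

alternating-∷ʳ : ∀ a b n → alternating a b n ∷ʳ alternate a b n ≡ alternating a b (suc n)
alternating-∷ʳ a b zero    = refl
alternating-∷ʳ a b (suc n) = cong (a ∷_) (alternating-∷ʳ b a n)

alternate-even : ∀ a b q → alternate a b (2 * q) ≡ a
alternate-even a b zero    = refl
alternate-even a b (suc q) = trans (cong (alternate a b) (*-suc 2 q)) (alternate-even a b q)

rotate-alternating : ∀ a b n → alternate a b n ≡ a → rotate (alternating a b n) ≡ alternating b a n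
rotate-alternating a b zero    _         = refl
rotate-alternating a b (suc n) alt≡a =
  subst (λ c → alternating b a n ∷ʳ c ≡ alternating b a (suc n)) alt≡a (alternating-∷ʳ b a n)

sizeB-∷ : ∀ {n} b (A : Vec Bool n) → sizeB (b ∷ A) ≡ sizeB (b ∷ []) + sizeB A
sizeB-∷ true  A = refl
sizeB-∷ false A = refl

sizeB-alternating : ∀ a b q → sizeB (alternating a b (2 * q)) ≡ q * sizeB (a ∷ b ∷ [])
sizeB-alternating a b zero    = refl
sizeB-alternating a b (suc q) = begin
  sizeB (alternating a b (2 * suc q))     ≡⟨ cong (λ n → sizeB (alternating a b n)) (*-suc 2 q) ⟩
  sizeB (a ∷ b ∷ A)                       ≡⟨ sizeB-∷ a _ ⟩
  sizeB (a ∷ []) + sizeB (b ∷ A)          ≡⟨ cong (_+_ (sizeB (a ∷ []))) (sizeB-∷ b A) ⟩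
  sizeB (a ∷ []) + (sizeB (b ∷ []) + sizeB A) ≡⟨ sym (+-assoc (sizeB (a ∷ [])) _ _) ⟩
  sizeB (a ∷ []) + sizeB (b ∷ []) + sizeB A ≡⟨ cong₂ _+_ (sym (sizeB-∷ a (b ∷ []))) (sizeB-alternating a b q) ⟩
  sizeB (a ∷ b ∷ []) + q * sizeB (a ∷ b ∷ []) ∎
  where
  open ≡-Reasoning
  A : Vec Bool (2 * q)
  A = alternating a b (2 * q)

2-periodic⇒alternating : ∀ {n} (A : Vec Bool n) → (∀ {j} → 2 + j < n → 2 + j ∈ᵇ A ≡ j ∈ᵇ A) →
  A ≡ alternating (0 ∈ᵇ A) (1 ∈ᵇ A) n
2-periodic⇒alternating {n} A periodic = ∈ᵇ-ext (λ {j} j<n → trans (go j j<n) (sym (∈ᵇ-alternating _ _ j j<n)))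
  where
  go : ∀ j → j < n → j ∈ᵇ A ≡ alternate (0 ∈ᵇ A) (1 ∈ᵇ A) j
  go zero          _   = refl
  go (suc zero)    _   = refl
  go (suc (suc j)) j<n = trans (periodic j<n) (go j (<-trans (m<n+m j z<s) j<n))

-- The cyclic group ℤ_N

[m+n%d]%d≡[m+n]%d : ∀ m n d .{{_ : NonZero d}} → (m + n % d) % d ≡ (m + n) % d
[m+n%d]%d≡[m+n]%d m n d = begin
  (m + n % d) % d           ≡⟨ %-distribˡ-+ m (n % d) d ⟩
  (m % d + n % d % d) % d   ≡⟨ cong (λ r → (m % d + r) % d) (m%n%n≡m%n n d) ⟩
  (m % d + n % d) % d       ≡⟨ sym (%-distribˡ-+ m n d) ⟩
  (m + n) % d               ∎
  where open ≡-Reasoning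

circDist-comm : ∀ N i j → circDist N i j ≡ circDist N j i
circDist-comm N i j = cong (λ δ → δ ⊓ (N ∸ δ)) (∣-∣-comm i j)

circDist-self : ∀ N j → circDist N j j ≡ 0
circDist-self N j = cong (λ δ → δ ⊓ (N ∸ δ)) (∣n-n∣≡0 j)

circDist-wrap : ∀ {N i j} → i < N → suc j ≡ N → circDist N i j ≡ circDist N (suc i) 0
circDist-wrap {i = i} {j} i<N refl = begin
  ∣ i - j ∣ ⊓ (suc j ∸ ∣ i - j ∣)  ≡⟨ cong (λ δ → δ ⊓ (suc j ∸ δ)) (m≤n⇒∣m-n∣≡n∸m i≤j) ⟩
  (j ∸ i) ⊓ (suc j ∸ (j ∸ i))      ≡⟨ cong ((j ∸ i) ⊓_) (trans (+-∸-assoc 1 (m∸n≤m j i)) (cong suc (m∸[m∸n]≡n i≤j))) ⟩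
  (j ∸ i) ⊓ suc i                  ≡⟨ ⊓-comm (j ∸ i) (suc i) ⟩
  suc i ⊓ (j ∸ i)                  ∎
  where
  open ≡-Reasoning
  i≤j : i ≤ j
  i≤j = s≤s⁻¹ i<N

circDist-double : ∀ m c a b → circDist (2 * m) (c + 2 * a) (c + 2 * b) ≡ 2 * circDist m a b
circDist-double m c a b = begin
  ∣ c + 2 * a - c + 2 * b ∣ ⊓ (2 * m ∸ ∣ c + 2 * a - c + 2 * b ∣)
    ≡⟨ cong (λ δ → δ ⊓ (2 * m ∸ δ)) (trans (∣m+n-m+o∣≡∣n-o∣ c (2 * a) (2 * b)) (sym (*-distribˡ-∣-∣ 2 a b))) ⟩
  (2 * ∣ a - b ∣) ⊓ (2 * m ∸ 2 * ∣ a - b ∣)   ≡⟨ cong ((2 * ∣ a - b ∣) ⊓_) (sym (*-distribˡ-∸ 2 m ∣ a - b ∣)) ⟩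
  (2 * ∣ a - b ∣) ⊓ (2 * (m ∸ ∣ a - b ∣))     ≡⟨ sym (*-distribˡ-⊓ 2 ∣ a - b ∣ (m ∸ ∣ a - b ∣)) ⟩
  2 * circDist m a b                     ∎
  where open ≡-Reasoning

circDist-bounds : ∀ {m a b} → a < m → b < m → a ≢ b → 1 ≤ circDist m a b × 2 * circDist m a b ≤ m
circDist-bounds {m} {a} {b} a<m b<m a≢b = ⊓-glb 1≤δ (m<n⇒0<n∸m δ<m) , (begin
  2 * (δ ⊓ (m ∸ δ))           ≡⟨ cong (_+_ (δ ⊓ (m ∸ δ))) (+-identityʳ _) ⟩
  δ ⊓ (m ∸ δ) + δ ⊓ (m ∸ δ)   ≤⟨ +-mono-≤ (m⊓n≤m δ (m ∸ δ)) (m⊓n≤n δ (m ∸ δ)) ⟩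
  δ + (m ∸ δ)                 ≡⟨ m+[n∸m]≡n (<⇒≤ δ<m) ⟩
  m                           ∎)
  where
  open ≤-Reasoning
  δ = ∣ a - b ∣
  δ<m : δ < m
  δ<m = ≤-<-trans (∣m-n∣≤m⊔n a b) (⊔-lub a<m b<m)
  1≤δ : 1 ≤ δ
  1≤δ = n≢0⇒n>0 (a≢b ∘ ∣m-n∣≡0⇒m≡n)

module Cyclic (N : ℕ) .{{_ : NonZero N}} where

  infix 5 _∈ᶜ_

  _∈ᶜ_ : ℕ → Vec Bool N → Bool
  j ∈ᶜ A = j % N ∈ᵇ A

  ∈ᶜ-< : ∀ {j} (A : Vec Bool N) → j < N → j ∈ᶜ A ≡ j ∈ᵇ A
  ∈ᶜ-< A j<N = cong (_∈ᵇ A) (m<n⇒m%n≡m j<N)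

  ∈ᶜ-ext : ∀ {A B} → (∀ j → j ∈ᶜ A ≡ j ∈ᶜ B) → A ≡ B
  ∈ᶜ-ext {A} {B} A≗B = ∈ᵇ-ext (λ j<N → trans (sym (∈ᶜ-< A j<N)) (trans (A≗B _) (∈ᶜ-< B j<N)))

  suc-mod-cases : ∀ {j} → j < N → (suc j < N × suc j % N ≡ suc j) ⊎ (suc j ≡ N × suc j % N ≡ 0)
  suc-mod-cases j<N with m≤n⇒m<n∨m≡n j<N
  ... | inj₁ 1+j<N = inj₁ (1+j<N , m<n⇒m%n≡m 1+j<N)
  ... | inj₂ 1+j≡N = inj₂ (1+j≡N , trans (%-congˡ 1+j≡N) (n%n≡0 N))

  suc-mod-injective : ∀ {i j} → i < N → j < N → suc i % N ≡ suc j % N → i ≡ j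
  suc-mod-injective i<N j<N eq with suc-mod-cases i<N | suc-mod-cases j<N
  ... | inj₁ (_ , eᵢ)     | inj₁ (_ , eⱼ)     = suc-injective (trans (sym eᵢ) (trans eq eⱼ))
  ... | inj₁ (_ , eᵢ)     | inj₂ (_ , eⱼ)     = contradiction (trans (sym eᵢ) (trans eq eⱼ)) 1+n≢0
  ... | inj₂ (_ , eᵢ)     | inj₁ (_ , eⱼ)     = contradiction (trans (sym eⱼ) (trans (sym eq) eᵢ)) 1+n≢0
  ... | inj₂ (1+i≡N , _) | inj₂ (1+j≡N , _) = suc-injective (trans 1+i≡N (sym 1+j≡N))

  ∈ᵇ-rotate : ∀ {j} (A : Vec Bool N) → j < N → j ∈ᵇ rotate A ≡ suc j % N ∈ᵇ A
  ∈ᵇ-rotate {j} A j<N with suc-mod-cases j<N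
  ... | inj₁ (1+j<N , e) = trans (∈ᵇ-rotate-< j A 1+j<N) (cong (_∈ᵇ A) (sym e))
  ... | inj₂ (1+j≡N , e) = trans (∈ᵇ-rotate-last j A 1+j≡N) (cong (_∈ᵇ A) (sym e))

  ∈ᶜ-rotate : ∀ (A : Vec Bool N) j → j ∈ᶜ rotate A ≡ suc j ∈ᶜ A
  ∈ᶜ-rotate A j = trans (∈ᵇ-rotate A (m%n<n j N)) (cong (_∈ᵇ A) ([m+n%d]%d≡[m+n]%d 1 j N))

  ∈ᶜ-iterate-rotate : ∀ (A : Vec Bool N) d j → j ∈ᶜ iterate rotate A d ≡ d + j ∈ᶜ A
  ∈ᶜ-iterate-rotate A zero    j = refl
  ∈ᶜ-iterate-rotate A (suc d) j =
    trans (∈ᶜ-iterate-rotate (rotate A) d j) (∈ᶜ-rotate A (d + j))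

  Periodic : Vec Bool N → ℕ → Set
  Periodic A d = ∀ j → d + j ∈ᶜ A ≡ j ∈ᶜ A

  Antiperiodic : Vec Bool N → ℕ → Set
  Antiperiodic A d = ∀ j → d + j ∈ᶜ A ≡ not (j ∈ᶜ A)

  periodic-N : ∀ A → Periodic A N
  periodic-N A j = cong (_∈ᵇ A) (trans (cong (_% N) (+-comm N j)) ([m+n]%n≡m%n j N))

  periodic-+ : ∀ A a b → Periodic A a → Periodic A b → Periodic A (a + b)
  periodic-+ A a b Pa Pb j = trans (cong (_∈ᶜ A) (+-assoc a b j)) (trans (Pa (b + j)) (Pb j))

  periodic-∸ : ∀ A a b → Periodic A a → Periodic A (a + b) → Periodic A b
  periodic-∸ A a b Pa Pab j = trans (sym (Pa (b + j))) (trans (cong (_∈ᶜ A) (sym (+-assoc a b j))) (Pab j))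

  periodic-* : ∀ A {d} → Periodic A d → ∀ k → Periodic A (k * d)
  periodic-* A     Pd zero    j = refl
  periodic-* A {d} Pd (suc k)   = periodic-+ A d (k * d) Pd (periodic-* A Pd k)

  antiperiodic⇒periodic : ∀ A {d} → Antiperiodic A d → Periodic A (2 * d)
  antiperiodic⇒periodic A {d} anti j = begin
    2 * d + j ∈ᶜ A        ≡⟨ cong (λ e → e + j ∈ᶜ A) (cong (_+_ d) (+-identityʳ d)) ⟩
    d + d + j ∈ᶜ A        ≡⟨ cong (_∈ᶜ A) (+-assoc d d j) ⟩
    d + (d + j) ∈ᶜ A      ≡⟨ anti (d + j) ⟩
    not (d + j ∈ᶜ A)      ≡⟨ cong not (anti j) ⟩
    not (not (j ∈ᶜ A))    ≡⟨ not-involutive _ ⟩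
    j ∈ᶜ A                ∎
    where open ≡-Reasoning

  periodic⇒iterate-rotate-fixed : ∀ A {d} → Periodic A d → iterate rotate A d ≡ A
  periodic⇒iterate-rotate-fixed A {d} Pd = ∈ᶜ-ext (λ j → trans (∈ᶜ-iterate-rotate A d j) (Pd j))

  circDist-suc : ∀ {i j} → i < N → j < N → circDist N (suc i % N) (suc j % N) ≡ circDist N i j
  circDist-suc {i} {j} i<N j<N with suc-mod-cases i<N | suc-mod-cases j<N
  ... | inj₁ (_ , eᵢ) | inj₁ (_ , eⱼ) = cong₂ (circDist N) eᵢ eⱼ
  ... | inj₁ (_ , eᵢ) | inj₂ (1+j≡N , eⱼ) = trans (cong₂ (circDist N) eᵢ eⱼ) (sym (circDist-wrap i<N 1+j≡N))
  ... | inj₂ (1+i≡N , eᵢ) | inj₁ (_ , eⱼ) = trans (cong₂ (circDist N) eᵢ eⱼ)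
    (trans (circDist-comm N 0 (suc j)) (sym (trans (circDist-comm N i j) (circDist-wrap j<N 1+i≡N))))
  ... | inj₂ (1+i≡N , eᵢ) | inj₂ (1+j≡N , eⱼ) = trans (cong₂ (circDist N) eᵢ eⱼ) (trans (circDist-self N 0)
    (sym (trans (cong (circDist N i) (suc-injective (trans 1+j≡N (sym 1+i≡N)))) (circDist-self N i))))

  circDist-translate : ∀ c {i j} → i < N → j < N → circDist N ((c + i) % N) ((c + j) % N) ≡ circDist N i j
  circDist-translate zero    i<N j<N = cong₂ (circDist N) (m<n⇒m%n≡m i<N) (m<n⇒m%n≡m j<N)
  circDist-translate (suc c) {i} {j} i<N j<N = begin
    circDist N (suc (c + i) % N) (suc (c + j) % N)
      ≡⟨ sym (cong₂ (circDist N) ([m+n%d]%d≡[m+n]%d 1 (c + i) N) ([m+n%d]%d≡[m+n]%d 1 (c + j) N)) ⟩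
    circDist N (suc ((c + i) % N) % N) (suc ((c + j) % N) % N)
      ≡⟨ circDist-suc (m%n<n (c + i) N) (m%n<n (c + j) N) ⟩
    circDist N ((c + i) % N) ((c + j) % N)
      ≡⟨ circDist-translate c i<N j<N ⟩
    circDist N i j ∎
    where open ≡-Reasoning

  2*d≤N⇒d<N : ∀ d → 2 * d ≤ N → d < N
  2*d≤N⇒d<N zero    _    = >-nonZero⁻¹ N
  2*d≤N⇒d<N (suc d) 2d≤N =
    <-≤-trans (m<m+n (suc d) z<s) (subst (_≤ N) (cong (_+_ (suc d)) (+-identityʳ (suc d))) 2d≤N)

  circDist-shift : ∀ {j d} → j < N → 2 * d ≤ N → circDist N j ((d + j) % N) ≡ d
  circDist-shift {j} {d} j<N 2d≤N = begin
    circDist N j ((d + j) % N)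
      ≡⟨ cong₂ (circDist N) (sym (trans (cong (_% N) (+-identityʳ j)) (m<n⇒m%n≡m j<N))) (cong (_% N) (+-comm d j)) ⟩
    circDist N ((j + 0) % N) ((j + d) % N)
      ≡⟨ circDist-translate j (>-nonZero⁻¹ N) d<N ⟩
    d ⊓ (N ∸ d)
      ≡⟨ m≤n⇒m⊓n≡m d≤N∸d ⟩
    d ∎
    where
    open ≡-Reasoning
    d+d≤N : d + d ≤ N
    d+d≤N = subst (_≤ N) (cong (_+_ d) (+-identityʳ d)) 2d≤N
    d≤N∸d : d ≤ N ∸ d
    d≤N∸d = m+n≤o⇒m≤o∸n d d+d≤N
    d<N : d < N
    d<N = 2*d≤N⇒d<N d 2d≤N

allB-sound : ∀ {A : Set} (f : A → Bool) {xs x} → allB f xs ≡ true → x ∈ xs → f x ≡ true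
allB-sound f {y ∷ xs} all≡true x∈xs with f y in fy≡
allB-sound f {y ∷ xs} all≡true (here refl)  | true = fy≡
allB-sound f {y ∷ xs} all≡true (there x∈xs) | true = allB-sound f all≡true x∈xs

allB-complete : ∀ {A : Set} (f : A → Bool) xs → (∀ {x} → x ∈ xs → f x ≡ true) → allB f xs ≡ true
allB-complete f []       _    = refl
allB-complete f (x ∷ xs) f≡true rewrite f≡true (here refl) = allB-complete f xs (f≡true ∘ there)

≡ᵇ≡false⇒≢ : ∀ {i j} → (i ≡ᵇ j) ≡ false → i ≢ j
≡ᵇ≡false⇒≢ {i} {j} i≡ᵇj≡false i≡j = subst T i≡ᵇj≡false (≡⇒≡ᵇ i j i≡j)

≢⇒≡ᵇ≡false : ∀ {i j} → i ≢ j → (i ≡ᵇ j) ≡ false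
≢⇒≡ᵇ≡false {i} {j} i≢j = ¬-not (λ i≡ᵇj≡true → i≢j (≡ᵇ⇒≡ i j (subst T (sym i≡ᵇj≡true) _)))

module Circulant (S : ℕ → Bool) (N : ℕ) .{{_ : NonZero N}} where

  open Cyclic N

  IsClique : Vec Bool N → Set
  IsClique A = ∀ {i j} → i < N → j < N → i ∈ᵇ A ≡ true → j ∈ᵇ A ≡ true → i ≢ j → S (circDist N i j) ≡ true

  isCliqueB⇒IsClique : ∀ A → isCliqueB S N A ≡ true → IsClique A
  isCliqueB⇒IsClique A isClique {i} {j} i<N j<N i∈A j∈A i≢j = subst (λ δ → S δ ≡ true)
    (cong₂ (circDist N) (toℕ-fromℕ< i<N) (toℕ-fromℕ< j<N))
    (entry⇒adjacent (membership i<N i∈A) (membership j<N j∈A)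
      (≢⇒≡ᵇ≡false (λ eq → i≢j (trans (sym (toℕ-fromℕ< i<N)) (trans eq (toℕ-fromℕ< j<N)))))
      (allB-sound _ (allB-sound _ isClique (∈-allFin (fromℕ< i<N))) (∈-allFin (fromℕ< j<N))))
    where
    membership : ∀ {k} (k<N : k < N) → k ∈ᵇ A ≡ true → lookup A (fromℕ< k<N) ≡ true
    membership k<N k∈A = trans (lookup≡∈ᵇ A _) (trans (cong (_∈ᵇ A) (toℕ-fromℕ< k<N)) k∈A)
    entry⇒adjacent : ∀ {a b c d} → a ≡ true → b ≡ true → c ≡ false →
      (if a ∧ b ∧ not c then not c ∧ d else true) ≡ true → d ≡ true
    entry⇒adjacent refl refl refl d≡true = d≡true

  IsClique⇒isCliqueB : ∀ A → IsClique A → isCliqueB S N A ≡ true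
  IsClique⇒isCliqueB A clique =
    allB-complete _ (allFin N) (λ {i} _ → allB-complete _ (allFin N) (λ {j} _ → entry i j))
    where
    entry : ∀ i j → (if lookup A i ∧ lookup A j ∧ not (toℕ i ≡ᵇ toℕ j) then adjB S N i j else true) ≡ true
    entry i j with lookup A i in i∈A | lookup A j in j∈A | toℕ i ≡ᵇ toℕ j in i≡ᵇj
    ... | false | _     | _     = refl
    ... | true  | false | _     = refl
    ... | true  | true  | true  = refl
    ... | true  | true  | false = clique (toℕ<n i) (toℕ<n j)
      (trans (sym (lookup≡∈ᵇ A i)) i∈A) (trans (sym (lookup≡∈ᵇ A j)) j∈A) (≡ᵇ≡false⇒≢ i≡ᵇj)

  IsClique-rotate : ∀ A → IsClique A → IsClique (rotate A)
  IsClique-rotate A clique i<N j<N i∈ j∈ i≢j = subst (λ δ → S δ ≡ true) (circDist-suc i<N j<N)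
    (clique (m%n<n _ N) (m%n<n _ N) (trans (sym (∈ᵇ-rotate A i<N)) i∈) (trans (sym (∈ᵇ-rotate A j<N)) j∈)
      (i≢j ∘ suc-mod-injective i<N j<N))

-- Circulant graphs of order 2m

odd-multiple : ∀ e q → e * (2 * (1 + 2 * q)) ≡ 2 * e + q * (2 * (2 * e))
odd-multiple = solve-∀

module EvenOrder (S : ℕ → Bool) (m : ℕ) .{{_ : NonZero m}} where

  private instance
    2m≢0 : NonZero (2 * m)
    2m≢0 = m*n≢0 2 m

  open Cyclic (2 * m)
  open Circulant S (2 * m)

  -- A and its translate by d are disjoint, as a common point would give two vertices of A at
  -- distance d; both have m = N/2 elements, so the translate is the complement of A.
  missing-distance⇒antiperiodic : ∀ A {d} → IsClique A → sizeB A ≡ m → 1 ≤ d → d ≤ m → S d ≡ false →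
    Antiperiodic A d
  missing-distance⇒antiperiodic A {d} clique |A|≡m 1≤d d≤m Sd≡false j = begin
    d + j ∈ᶜ A    ≡⟨ sym (∈ᶜ-iterate-rotate A d j) ⟩
    j ∈ᶜ B        ≡⟨ Disjoint∧sizes⇒complement A B disjoint sizes (m%n<n j (2 * m)) ⟩
    not (j ∈ᶜ A)  ∎
    where
    open ≡-Reasoning
    B : Vec Bool (2 * m)
    B = iterate rotate A d

    sizes : sizeB A + sizeB B ≡ 2 * m
    sizes = trans (cong₂ _+_ |A|≡m (trans (sizeB-iterate-rotate A d) |A|≡m)) (cong (_+_ m) (sym (+-identityʳ m)))

    disjoint : Disjoint A B
    disjoint {i} i<N i∈A i∈B = contradiction (trans (sym (subst (λ δ → S δ ≡ true) shift S-true)) Sd≡false) (λ ())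
      where
      shift : circDist (2 * m) i ((d + i) % (2 * m)) ≡ d
      shift = circDist-shift i<N (*-monoʳ-≤ 2 d≤m)
      d+i∈A : d + i ∈ᶜ A ≡ true
      d+i∈A = trans (sym (∈ᶜ-iterate-rotate A d i)) (trans (∈ᶜ-< B i<N) i∈B)
      i≢d+i : i ≢ (d + i) % (2 * m)
      i≢d+i i≡d+i = <⇒≢ 1≤d (trans (sym (circDist-self (2 * m) i)) (trans (cong (circDist (2 * m) i) i≡d+i) shift))
      S-true : S (circDist (2 * m) i ((d + i) % (2 * m))) ≡ true
      S-true = clique i<N (m%n<n (d + i) (2 * m)) i∈A d+i∈A i≢d+i

  EvenDistances : Set
  EvenDistances = ∀ {e} → 1 ≤ e → 2 * e ≤ m → S (2 * e) ≡ true

  -- As m is odd, e · 2m = d + q · 2d is an odd multiple of the antiperiod d = 2e.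
  odd⇒EvenDistances : ∀ q → m ≡ 1 + 2 * q → ∀ A → IsClique A → sizeB A ≡ m → EvenDistances
  odd⇒EvenDistances q m≡1+2q A clique |A|≡m {e} 1≤e 2e≤m with S (2 * e) in S2e
  ... | true  = refl
  ... | false = contradiction self-complementary (not-¬ refl)
    where
    d : ℕ
    d = 2 * e
    anti : Antiperiodic A d
    anti = missing-distance⇒antiperiodic A clique |A|≡m (≤-trans 1≤e (m≤m+n e (e + 0))) 2e≤m S2e
    self-complementary : 0 ∈ᶜ A ≡ not (0 ∈ᶜ A)
    self-complementary = begin
      0 ∈ᶜ A                         ≡⟨ sym (periodic-* A (periodic-N A) e 0) ⟩
      e * (2 * m) + 0 ∈ᶜ A           ≡⟨ cong (λ k → k + 0 ∈ᶜ A) e·2m≡d+q·2d ⟩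
      d + q * (2 * d) + 0 ∈ᶜ A       ≡⟨ cong (_∈ᶜ A) (+-assoc d (q * (2 * d)) 0) ⟩
      d + (q * (2 * d) + 0) ∈ᶜ A     ≡⟨ anti _ ⟩
      not (q * (2 * d) + 0 ∈ᶜ A)     ≡⟨ cong not (periodic-* A (antiperiodic⇒periodic A anti) q 0) ⟩
      not (0 ∈ᶜ A)                   ∎
      where
      open ≡-Reasoning
      e·2m≡d+q·2d : e * (2 * m) ≡ d + q * (2 * d)
      e·2m≡d+q·2d = trans (cong (λ n → e * (2 * n)) m≡1+2q) (odd-multiple e q)

  parity-class-clique : EvenDistances → ∀ A c → (∀ {j} → j < 2 * m → j ∈ᵇ A ≡ true → ∃[ k ] j ≡ c + 2 * k) →
    IsClique A
  parity-class-clique even A c parity i<N j<N i∈A j∈A i≢j with parity i<N i∈A | parity j<N j∈A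
  ... | a , refl | b , refl =
    subst (λ δ → S δ ≡ true) (sym (circDist-double m c a b)) (even (proj₁ bounds) (proj₂ bounds))
    where
    half : ∀ {k} → c + 2 * k < 2 * m → k < m
    half {k} lt = *-cancelˡ-< 2 k m (≤-<-trans (m≤n+m (2 * k) c) lt)
    bounds : 1 ≤ circDist m a b × 2 * circDist m a b ≤ m
    bounds = circDist-bounds (half {a} i<N) (half {b} j<N) (λ a≡b → i≢j (cong (λ k → c + 2 * k) a≡b))

  evens odds : Vec Bool (2 * m)
  evens = alternating true false (2 * m)
  odds  = alternating false true (2 * m)

  evens≢odds : evens ≢ odds
  evens≢odds evens≡odds = contradiction (trans (sym (∈ᵇ-alternating true false 0 0<2m))
    (trans (cong (0 ∈ᵇ_) evens≡odds) (∈ᵇ-alternating false true 0 0<2m))) (λ ())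
    where
    0<2m : 0 < 2 * m
    0<2m = >-nonZero⁻¹ (2 * m)

  alternating-clique : EvenDistances → ∀ {a b} → a ≢ b → IsClique (alternating a b (2 * m))
  alternating-clique even {true}  {false} _ = parity-class-clique even evens 0 parity
    where
    parity : ∀ {j} → j < 2 * m → j ∈ᵇ evens ≡ true → ∃[ k ] j ≡ 2 * k
    parity {j} j<N j∈ with alternate-true true false j (trans (sym (∈ᵇ-alternating true false j j<N)) j∈)
    ... | inj₁ (_ , j≡2k) = j≡2k
  alternating-clique even {false} {true}  _ = parity-class-clique even odds 1 parity
    where
    parity : ∀ {j} → j < 2 * m → j ∈ᵇ odds ≡ true → ∃[ k ] j ≡ 1 + 2 * k
    parity {j} j<N j∈ with alternate-true false true j (trans (sym (∈ᵇ-alternating false true j j<N)) j∈)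
    ... | inj₂ (_ , j≡1+2k) = j≡1+2k
  alternating-clique even {true}  {true}  a≢b = contradiction refl a≢b
  alternating-clique even {false} {false} a≢b = contradiction refl a≢b

  rotate²-alternating : ∀ a b → rotate² (alternating a b (2 * m)) ≡ alternating a b (2 * m)
  rotate²-alternating a b = trans (cong rotate (rotate-alternating a b (2 * m) (alternate-even a b m)))
    (rotate-alternating b a (2 * m) (alternate-even b a m))

  rotate²-fixed⇒evens⊎odds : ∀ {A} → rotate² A ≡ A → sizeB A ≡ m → A ≡ evens ⊎ A ≡ odds
  rotate²-fixed⇒evens⊎odds {A} fixed |A|≡m = classify (0 ∈ᵇ A) (1 ∈ᵇ A) (2-periodic⇒alternating A periodic)
    where
    periodic : ∀ {j} → 2 + j < 2 * m → 2 + j ∈ᵇ A ≡ j ∈ᵇ A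
    periodic {j} 2+j<N = begin
      2 + j ∈ᵇ A               ≡⟨ sym (∈ᵇ-rotate-< (suc j) A 2+j<N) ⟩
      suc j ∈ᵇ rotate A        ≡⟨ sym (∈ᵇ-rotate-< j (rotate A) (<-trans (n<1+n (suc j)) 2+j<N)) ⟩
      j ∈ᵇ rotate² A           ≡⟨ cong (j ∈ᵇ_) fixed ⟩
      j ∈ᵇ A                   ∎
      where open ≡-Reasoning
    size : ∀ a b → A ≡ alternating a b (2 * m) → m ≡ m * sizeB (a ∷ b ∷ [])
    size a b refl = trans (sym |A|≡m) (sizeB-alternating a b m)
    classify : ∀ a b → A ≡ alternating a b (2 * m) → A ≡ evens ⊎ A ≡ odds
    classify true  false A≡ = inj₁ A≡
    classify false true  A≡ = inj₂ A≡
    classify true  true  A≡ = contradiction (*-cancelˡ-≡ 1 2 m (trans (*-identityʳ m) (size true true A≡))) (λ ())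
    classify false false A≡ = contradiction (trans (size false false A≡) (*-zeroʳ m)) (≢-nonZero⁻¹ m)

  coprime-missing-distance⇒rotate²-fixed : ∀ A {t} → IsClique A → sizeB A ≡ m →
    1 ≤ t → t ≤ m → S t ≡ false → Coprime t m → rotate² A ≡ A
  coprime-missing-distance⇒rotate²-fixed A clique |A|≡m 1≤t t≤m St≡false t⊥m =
    periodic⇒iterate-rotate-fixed A (coprime⇒closure∋1 (λ s → Periodic A (2 * s)) +-closed ∸-closed
      (antiperiodic⇒periodic A (missing-distance⇒antiperiodic A clique |A|≡m 1≤t t≤m St≡false))
      (periodic-N A) t⊥m)
    where
    +-closed : ∀ a b → Periodic A (2 * a) → Periodic A (2 * b) → Periodic A (2 * (a + b))
    +-closed a b Pa Pb = subst (Periodic A) (sym (*-distribˡ-+ 2 a b)) (periodic-+ A (2 * a) (2 * b) Pa Pb)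
    ∸-closed : ∀ a b → Periodic A (2 * a) → Periodic A (2 * (a + b)) → Periodic A (2 * b)
    ∸-closed a b Pa Pab = periodic-∸ A (2 * a) (2 * b) Pa (subst (Periodic A) (*-distribˡ-+ 2 a b) Pab)

  open FixedPointCount {Vec Bool (2 * m)} (≡-dec _≟ᵇ_)

  -- Definitionally the list whose length is numCliques S (2 * m) m.
  Cliques : List (Vec Bool (2 * m))
  Cliques = filter (λ A → T? (isCliqueB S (2 * m) A ∧ (sizeB A ≡ᵇ m))) (allSubsets (2 * m))

  ∈-Cliques⁻ : ∀ {A} → A ∈ Cliques → IsClique A × sizeB A ≡ m
  ∈-Cliques⁻ {A} A∈ with Equivalence.to T-∧ (proj₂ (∈-filter⁻ _ {xs = allSubsets (2 * m)} A∈))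
  ... | isClique , size = isCliqueB⇒IsClique A (Equivalence.to T-≡ isClique) , ≡ᵇ⇒≡ (sizeB A) m size

  ∈-Cliques⁺ : ∀ A → IsClique A → sizeB A ≡ m → A ∈ Cliques
  ∈-Cliques⁺ A clique |A|≡m = ∈-filter⁺ _ (∈-allSubsets A)
    (Equivalence.from T-∧ (Equivalence.from T-≡ (IsClique⇒isCliqueB A clique) , ≡⇒≡ᵇ (sizeB A) m |A|≡m))

  Cliques-unique : Unique Cliques
  Cliques-unique = Unique.filter⁺ _ (allSubsets-unique (2 * m))

  Cliques-invariant : Invariant rotate² Cliques
  Cliques-invariant {A} A∈ = ∈-Cliques⁺ (rotate² A)
    (IsClique-rotate (rotate A) (IsClique-rotate A (proj₁ (∈-Cliques⁻ A∈))))
    (trans (sizeB-rotate (rotate A)) (trans (sizeB-rotate A) (proj₂ (∈-Cliques⁻ A∈))))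

  Cliques-periodic : PeriodicOn rotate² m Cliques
  Cliques-periodic {A} _ = trans (sym (iterate-* rotate A m 2))
    (periodic⇒iterate-rotate-fixed A (subst (Periodic A) (*-comm 2 m) (periodic-N A)))

  fixed-Cliques : EvenDistances → length (filter (fixed? rotate²) Cliques) ≡ 2
  fixed-Cliques even = length-unique-pair fixed-unique evens⊎odds
    (fixed-∈ (∈-Cliques⁺ evens (alternating-clique even (λ ())) |evens|≡m) (rotate²-alternating true false))
    (fixed-∈ (∈-Cliques⁺ odds (alternating-clique even (λ ())) |odds|≡m) (rotate²-alternating false true))
    evens≢odds
    where
    fixed-∈ : ∀ {A} → A ∈ Cliques → rotate² A ≡ A → A ∈ filter (fixed? rotate²) Cliques
    fixed-∈ = ∈-filter⁺ (fixed? rotate²)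
    fixed-∈⁻ : ∀ {A} → A ∈ filter (fixed? rotate²) Cliques → A ∈ Cliques × rotate² A ≡ A
    fixed-∈⁻ = ∈-filter⁻ (fixed? rotate²)
    fixed-unique : Unique (filter (fixed? rotate²) Cliques)
    fixed-unique = Unique.filter⁺ (fixed? rotate²) Cliques-unique
    |evens|≡m : sizeB evens ≡ m
    |evens|≡m = trans (sizeB-alternating true false m) (*-identityʳ m)
    |odds|≡m : sizeB odds ≡ m
    |odds|≡m = trans (sizeB-alternating false true m) (*-identityʳ m)
    evens⊎odds : ∀ {A} → A ∈ filter (fixed? rotate²) Cliques → A ≡ evens ⊎ A ≡ odds
    evens⊎odds A∈ = rotate²-fixed⇒evens⊎odds (proj₂ (fixed-∈⁻ A∈)) (proj₂ (∈-Cliques⁻ (proj₁ (fixed-∈⁻ A∈))))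

  nonempty⇒EvenDistances : ∀ q → m ≡ 1 + 2 * q → length Cliques ≢ 0 → EvenDistances
  nonempty⇒EvenDistances q m-odd nonempty with nonempty⇒∈ nonempty
  ... | A , A∈ = odd⇒EvenDistances q m-odd A (proj₁ (∈-Cliques⁻ A∈)) (proj₂ (∈-Cliques⁻ A∈))

  coprime-missing-distance⇒Cliques-fixed : ∀ {t} → 1 ≤ t → t ≤ m → S t ≡ false → Coprime t m →
    filter (fixed? rotate²) Cliques ≡ Cliques
  coprime-missing-distance⇒Cliques-fixed 1≤t t≤m St≡false t⊥m = filter-all (fixed? rotate²) (All.tabulate
    (λ {A} A∈ → coprime-missing-distance⇒rotate²-fixed A (proj₁ (∈-Cliques⁻ A∈)) (proj₂ (∈-Cliques⁻ A∈))
      1≤t t≤m St≡false t⊥m))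

coprime-missing-distance : ∀ {p} k .{{_ : NonZero p}} {S : ℕ → Bool} →
  (S 1 ≡ false ⊎ (S 1 ≡ true × ∃[ t ] (1 ≤ t × t ≤ p ^ k × gcd t (2 * p) ≡ 1 × S t ≡ false))) →
  ∃[ t ] (1 ≤ t × t ≤ p ^ k × S t ≡ false × Coprime t (p ^ k))
coprime-missing-distance {p} k (inj₁ S1≡false) = 1 , ≤-refl , m^n>0 p k , S1≡false , 1-coprimeTo (p ^ k)
coprime-missing-distance k (inj₂ (_ , t , 1≤t , t≤p^k , gcd≡1 , St≡false)) =
  t , 1≤t , t≤p^k , St≡false , coprime-^ʳ (coprime-∣ʳ (gcd≡1⇒coprime gcd≡1) (n∣m*n 2)) k

proposition2p7 : (p k : ℕ) → Prime p → p ≢ 2 → 0 < k →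
    (S : ℕ → Bool) → (∀ d → S d ≡ true → 1 ≤ d × d ≤ p ^ k) →
    (numCliques S (2 * p ^ k) (p ^ k) ≢ 0 →
      (+ p) ∣ (+ numCliques S (2 * p ^ k) (p ^ k) - + 2))
    ×
    (numCliques S (2 * p ^ k) (p ^ k) ≢ 0 →
      (S 1 ≡ false
        ⊎ (S 1 ≡ true × ∃[ t ] (1 ≤ t × t ≤ p ^ k × gcd t (2 * p) ≡ 1 × S t ≡ false))) →
      numCliques S (2 * p ^ k) (p ^ k) ≡ 2)
proposition2p7 p k p-prime p≢2 _ S _ = divisible , exactly-two
  where
  instance
    p≢0 : NonZero p
    p≢0 = prime⇒nonZero p-prime
    p^k≢0 : NonZero (p ^ k)
    p^k≢0 = m^n≢0 p k
  open EvenOrder S (p ^ k)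
  open FixedPointCount {Vec Bool (2 * p ^ k)} (≡-dec _≟ᵇ_)

  two-fixed : length Cliques ≢ 0 → length (filter (fixed? rotate²) Cliques) ≡ 2
  two-fixed nonempty with prime≢2⇒odd p-prime p≢2
  ... | q , p-odd with odd-^ q p-odd k
  ... | r , p^k-odd = fixed-Cliques (nonempty⇒EvenDistances r p^k-odd nonempty)

  divisible : length Cliques ≢ 0 → (+ p) ∣ (+ length Cliques - + 2)
  divisible nonempty with count-mod-prime-power rotate² p-prime k Cliques-unique Cliques-invariant Cliques-periodic
  -- + (2 + r * p) - + 2 computes to + (r * p), whose absolute value p divides.
  ... | r , |Cliques|≡ = subst (λ n → (+ p) ∣ (+ n - + 2))
    (sym (trans |Cliques|≡ (cong (_+ r * p) (two-fixed nonempty)))) (n∣m*n r)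

  exactly-two : length Cliques ≢ 0 →
    (S 1 ≡ false ⊎ (S 1 ≡ true × ∃[ t ] (1 ≤ t × t ≤ p ^ k × gcd t (2 * p) ≡ 1 × S t ≡ false))) →
    length Cliques ≡ 2
  exactly-two nonempty condition with coprime-missing-distance k condition
  ... | t , 1≤t , t≤p^k , St≡false , t⊥p^k =
    trans (cong length (sym (coprime-missing-distance⇒Cliques-fixed 1≤t t≤p^k St≡false t⊥p^k)))
      (two-fixed nonempty)
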